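{- Let $\tau\in(\Sigma\cup\{*\})^n$ be a partial assignment and $\mathcal{C}$ a configuration. If $\mathcal{C}$ is a container of $\tau$, then $\tau$ is consistent and $\mathcal{C}$ contains at most $|\mathrm{supp}(\tau)|$ bracket pairs.
   Context: Let $\Sigma=\{\text{red }[\,],\ \text{blue }[\,],\ \text{red }[,\ \text{blue }[,\ \text{red }],\ \text{blue }]\}\times[n]$, writing $\sigma=(b(\sigma),p(\sigma))$ with bracket type $b(\sigma)$ and pointer $p(\sigma)\in[n]$. Axioms on $s\in\Sigma^n$: (A1) $b(s_1)\in\{\text{red }[\,],\text{red }[\}$, $b(s_n)\in\{\text{blue }[\,],\text{blue }]\}$; (A2) if $p(s_i)=j$ then $p(s_j)=i$ (write $s_i\sim s_j$, a bracket pair); if $s_i\sim s_i$ then $b(s_i)$ is a trivial bracket (red $[\,]$ or blue $[\,]$); if $s_i\sim s_j$, $i<j$, then $b(s_i)$ is opening, $b(s_j)$ closing, same colour; (A3) no $s_i\sim s_j$, $s_{i'}\sim s_{j'}$ with $i<i'<j<j'$; (A4) for $i\in[n-1]$, $b(s_i)b(s_{i+1})\notin\{\text{red }]\,\text{blue }[,\ \text{red }]\,\text{blue }[\,],\ \text{red }[\,]\,\text{blue }[,\ \text{red }[\,]\,\text{blue }[\,]\}$. A partial assignment $\tau\in(\Sigma\cup\{*\})^n$ is consistent if it falsifies none of these axioms; $\mathrm{supp}(\tau)=\{i:\tau_i\neq*\}$. A configuration is a consistent partial assignment such that whenever it assigns $i$ with $p(\mathcal{C}_i)=j$ it also assigns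 $j$; it is identified with its set of bracket pairs. The area of a bracket pair is the set of indices it encloses (from its opening to its closing position), and $\mathrm{area}(\mathcal{C})$ is the union of the areas of its pairs. $\mathcal{C}$ is closed if it assigns every index in $\mathrm{area}(\mathcal{C})$, and locally consistent if some closed configuration extends it. A pair $P\in\mathcal{C}$ is top-level if $\mathrm{area}(P)\not\subseteq\mathrm{area}(P')$ for all other $P'\in\mathcal{C}$. $\mathcal{C}$ is monotone if there is an index $i$ such that all red top-level pairs lie before $i$ and all blue top-level pairs after $i$. $\mathcal{C}$ dominates $\tau$ if $\mathrm{supp}(\tau)\subseteq\mathrm{area}(\mathcal{C})$ and some closed configuration $\mathcal{C}'$ extends both $\mathcal{C}$ and $\tau$. A container of $\tau$ is a locally consistent monotone configuration $\mathcal{C}$ that dominates $\tau$ and is minimal with this property: removing any bracket pair from $\mathcal{C}$ yields a configuration not dominating $\tau$. -}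

module Defs where

open import Data.Nat using (ℕ; zero; suc; _+_; _≤ᵇ_) renaming (_<_ to _<ℕ_; _≤_ to _≤ℕ_)
open import Data.Fin using (Fin; toℕ; _≟_) renaming (zero to fzero; suc to fsuc)
open import Data.Fin using (_<_; _≤_)
open import Data.Maybe using (Maybe; just; nothing; is-just)
open import Data.Product using (Σ; ∃; _×_; _,_)
open import Data.Bool using (Bool; true; false; if_then_else_; _∨_)
open import Data.Empty using (⊥)
open import Relation.Nullary using (¬_; does)
open import Relation.Binary.PropositionalEquality using (_≡_; _≢_)

-- Bracket types: colour × kind.  red [] = (red , triv), red [ = (red , opn),
-- red ] = (red , cls), and likewise for blue.
data Colour : Set where
  red blue : Colour

data Kind : Set where
  triv opn cls : Kind

record Sym (n : ℕ) : Set where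
  constructor sym
  field
    colour : Colour
    kind   : Kind
    ptr    : Fin n
open Sym public

-- partial assignment: nothing = *
PA : ℕ → Set
PA n = Fin n → Maybe (Sym n)

Pair : ∀ {n} → PA n → Fin n → Fin n → Set
Pair τ i j = Σ (Sym _) λ σ → Σ (Sym _) λ σ' →
  τ i ≡ just σ × τ j ≡ just σ' × ptr σ ≡ j × ptr σ' ≡ i

Bad4 : ∀ {n} → Sym n → Sym n → Set
Bad4 σ σ' = colour σ ≡ red × (kind σ ≡ cls Data.Sum.⊎ kind σ ≡ triv)
          × colour σ' ≡ blue × (kind σ' ≡ opn Data.Sum.⊎ kind σ' ≡ triv)
  where import Data.Sum

Consistent : ∀ {n} → PA n → Set
Consistent {n} τ =
  (∀ (i : Fin n) σ → toℕ i ≡ 0 → τ i ≡ just σ → colour σ ≡ red × kind σ ≢ cls)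
  × (∀ (i : Fin n) σ → suc (toℕ i) ≡ n → τ i ≡ just σ → colour σ ≡ blue × kind σ ≢ opn)
  × (∀ i j σ σ' → τ i ≡ just σ → ptr σ ≡ j → τ j ≡ just σ' → ptr σ' ≡ i)
  × (∀ i σ → τ i ≡ just σ → ptr σ ≡ i → kind σ ≡ triv)
  × (∀ i j σ σ' → τ i ≡ just σ → τ j ≡ just σ' → ptr σ ≡ j → ptr σ' ≡ i → i < j
        → kind σ ≡ opn × kind σ' ≡ cls × colour σ ≡ colour σ')
  × (∀ i j i' j' → Pair τ i j → Pair τ i' j' → i < i' → i' < j → j < j' → ⊥)
  × (∀ i j σ σ' → suc (toℕ i) ≡ toℕ j → τ i ≡ just σ → τ j ≡ just σ' → Bad4 σ σ' → ⊥)

Assigned : ∀ {n} → PA n → Fin n → Set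
Assigned τ i = ∃ λ σ → τ i ≡ just σ

Configuration : ∀ {n} → PA n → Set
Configuration C = Consistent C × (∀ i σ → C i ≡ just σ → Assigned C (ptr σ))

Area : ∀ {n} → Fin n → Fin n → Fin n → Set
Area i j k = i ≤ k × k ≤ j

InArea : ∀ {n} → PA n → Fin n → Set
InArea C k = ∃ λ i → ∃ λ j → Pair C i j × i ≤ j × Area i j k

Closed : ∀ {n} → PA n → Set
Closed C = ∀ k → InArea C k → Assigned C k

Extends : ∀ {n} → PA n → PA n → Set
Extends C' C = ∀ i σ → C i ≡ just σ → C' i ≡ just σ

LocallyConsistent : ∀ {n} → PA n → Set
LocallyConsistent C = ∃ λ C' → Configuration C' × Closed C' × Extends C' C

TopLevel : ∀ {n} → PA n → Fin n → Fin n → Set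
TopLevel C i j = Pair C i j × i ≤ j ×
  (∀ i' j' → Pair C i' j' → i' ≤ j' → ¬ (i' ≡ i × j' ≡ j)
     → ¬ (∀ k → Area i j k → Area i' j' k))

Monotone : ∀ {n} → PA n → Set
Monotone C = ∃ λ (m : ℕ) → ∀ i j σ → TopLevel C i j → C i ≡ just σ →
  (colour σ ≡ red → toℕ j <ℕ m) × (colour σ ≡ blue → m ≤ℕ toℕ i)

Dominates : ∀ {n} → PA n → PA n → Set
Dominates C τ = (∀ k → Assigned τ k → InArea C k)
  × ∃ λ C' → Configuration C' × Closed C' × Extends C' C × Extends C' τ

remove : ∀ {n} → PA n → Fin n → Fin n → PA n
remove C i j k = if does (k ≟ i) ∨ does (k ≟ j) then nothing else C k

Container : ∀ {n} → PA n → PA n → Set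
Container C τ = LocallyConsistent C × Monotone C × Dominates C τ
  × (∀ i j → Pair C i j → i ≤ j → ¬ Dominates (remove C i j) τ)

count : ∀ {n} → (Fin n → Bool) → ℕ
count {zero} f = 0
count {suc n} f = (if f fzero then 1 else 0) + count (λ i → f (fsuc i))

suppSize : ∀ {n} → PA n → ℕ
suppSize τ = count (λ i → is-just (τ i))

-- number of bracket pairs: counted at their opening (or trivial) position
numPairs : ∀ {n} → PA n → ℕ
numPairs C = count λ i → f i (C i)
  where
  f : _ → Maybe (Sym _) → Bool
  f i nothing = false
  f i (just σ) = toℕ i ≤ᵇ toℕ (ptr σ)

-- τ is consistent because the closed configuration witnessing domination extends it.
-- That closed configuration also extends C minus any pair (i , j), so by minimality removing
-- (i , j) must uncover some k ∈ supp τ.  The pair of C that covered k then shares an endpoint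
-- with (i , j), hence opens at i; so k determines i, and k ↦ i injects the pairs of C into
-- supp τ.
module Submission where

open import Defs hiding (sym)
open import Data.Nat using (ℕ; _≤_; _+_; zero; suc; z≤n; s≤s)
open import Data.Nat.Properties using (≤ᵇ⇒≤; module ≤-Reasoning)
open import Data.Fin using (Fin; toℕ; _≟_) renaming (zero to fzero; suc to fsuc; _≤_ to _≤ᶠ_)
open import Data.Fin.Properties using (≤-antisym; _≤?_; any?; ¬∀⟶∃¬; suc-injective; 0≢1+n)
open import Data.Bool using (Bool; true; false; T; _∧_; not)
open import Data.Bool.Properties using (∧-identityʳ; T-∧)
open import Data.Maybe using (just; nothing; is-just)
open import Data.Maybe.Properties using (just-injective)
open import Data.Product using (∃; _×_; _,_; proj₁; proj₂)
open import Data.Empty using (⊥-elim)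
open import Function using (_∘_; const)
open import Function.Bundles using (Equivalence)
open import Relation.Nullary using (¬_; Dec; yes; no; does)
open import Relation.Nullary.Decidable using (_×-dec_; _→-dec_; dec-false; decidable-stable)
open import Relation.Binary.PropositionalEquality
  using (_≡_; _≢_; refl; sym; trans; cong; subst)

private
  variable
    m n : ℕ

count-cong : {P Q : Fin n → Bool} → (∀ i → P i ≡ Q i) → count P ≡ count Q
count-cong {zero}  P≗Q = refl
count-cong {suc n} P≗Q rewrite P≗Q fzero = cong (_ +_) (count-cong (P≗Q ∘ fsuc))

_without_ : (Fin n → Bool) → Fin n → Fin n → Bool
(Q without k) x = Q x ∧ not (does (x ≟ k))

count-without : (Q : Fin n → Bool) {k : Fin n} → T (Q k) → count Q ≡ suc (count (Q without k))
count-without {suc n} Q {fzero} Qk with Q fzero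
... | true = cong suc (count-cong λ i → sym (∧-identityʳ (Q (fsuc i))))
count-without {suc n} Q {fsuc k} Qk with Q fzero
... | true  = cong suc (count-without (Q ∘ fsuc) Qk)
... | false = count-without (Q ∘ fsuc) Qk

count-≤-injection : (P : Fin m → Bool) (Q : Fin n → Bool) (f : ∀ i → T (P i) → Fin n)
  → (∀ i p → T (Q (f i p)))
  → (∀ {i j} p q → f i p ≡ f j q → i ≡ j)
  → count P ≤ count Q
count-≤-injection {zero} P Q f f∈Q f-inj = z≤n
count-≤-injection {suc m} P Q f f∈Q f-inj with P fzero in P0
... | false = count-≤-injection (P ∘ fsuc) Q (f ∘ fsuc) (f∈Q ∘ fsuc)
                (λ p q → suc-injective ∘ f-inj p q)
... | true = begin
  suc (count (P ∘ fsuc))               ≤⟨ s≤s (count-≤-injection (P ∘ fsuc) (Q without f fzero p₀)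
                                               (f ∘ fsuc) f∈Q-without (λ p q → suc-injective ∘ f-inj p q)) ⟩
  suc (count (Q without f fzero p₀))   ≡⟨ sym (count-without Q (f∈Q fzero p₀)) ⟩
  count Q                              ∎
  where
  open ≤-Reasoning
  p₀ : T (P fzero)
  p₀ = subst T (sym P0) _
  f∈Q-without : ∀ i p → T ((Q without f fzero p₀) (f (fsuc i) p))
  f∈Q-without i p = Equivalence.from T-∧
    (f∈Q (fsuc i) p , subst (T ∘ not) (sym (dec-false (_ ≟ _) (λ eq → 0≢1+n (sym (f-inj p p₀ eq))))) _)

Consistent-downward : {C τ : PA n} → Extends C τ → Consistent C → Consistent τ
Consistent-downward {C = C} {τ} C⊒τ (first , last , ptr-sym , self-triv , orient , no-cross , adjacent) =
  (λ i σ i≡0 → first i σ i≡0 ∘ C⊒τ i σ) ,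
  (λ i σ i≡n → last i σ i≡n ∘ C⊒τ i σ) ,
  (λ i j σ σ' e p e' → ptr-sym i j σ σ' (C⊒τ i σ e) p (C⊒τ j σ' e')) ,
  (λ i σ → self-triv i σ ∘ C⊒τ i σ) ,
  (λ i j σ σ' e e' → orient i j σ σ' (C⊒τ i σ e) (C⊒τ j σ' e')) ,
  (λ i j i' j' P P' → no-cross i j i' j' (Pair-⊒ P) (Pair-⊒ P')) ,
  (λ i j σ σ' i+1≡j e e' → adjacent i j σ σ' i+1≡j (C⊒τ i σ e) (C⊒τ j σ' e'))
  where
  Pair-⊒ : ∀ {a b} → Pair τ a b → Pair C a b
  Pair-⊒ (σ , σ' , e , e' , p , p') = σ , σ' , C⊒τ _ σ e , C⊒τ _ σ' e' , p , p'

Extends-trans : {C C' C'' : PA n} → Extends C C' → Extends C' C'' → Extends C C''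
Extends-trans C⊒C' C'⊒C'' i σ = C⊒C' i σ ∘ C'⊒C'' i σ

Extends-remove : (C : PA n) (i j : Fin n) → Extends C (remove C i j)
Extends-remove C i j k σ e with k ≟ i | k ≟ j
... | no _ | no _ = e

remove-other : (C : PA n) {i j k : Fin n} → k ≢ i → k ≢ j → remove C i j k ≡ C k
remove-other C {i} {j} {k} k≢i k≢j rewrite dec-false (k ≟ i) k≢i | dec-false (k ≟ j) k≢j = refl

Pair-sym : {C : PA n} {a b : Fin n} → Pair C a b → Pair C b a
Pair-sym (σ , σ' , e , e' , p , p') = σ' , σ , e' , e , p' , p

Pair-functional : {C : PA n} {a b b' : Fin n} → Pair C a b → Pair C a b' → b ≡ b'
Pair-functional (σ , _ , e , _ , p , _) (σ₂ , _ , e₂ , _ , q , _) =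
  trans (sym p) (trans (cong ptr (just-injective (trans (sym e) e₂))) q)

Pair-remove : {C : PA n} {i j a b : Fin n} → Pair C i j → Pair C a b
  → i ≤ᶠ j → a ≤ᶠ b → a ≢ i → Pair (remove C i j) a b
Pair-remove {C = C} {i} {j} {a} {b} ij ab@(α , β , ea , eb , pa , pb) i≤j a≤b a≢i =
  α , β , trans (remove-other C a≢i a≢j) ea , trans (remove-other C b≢i b≢j) eb , pa , pb
  where
  collapse : a ≡ j → b ≡ i → a ≡ i
  collapse refl refl = ≤-antisym a≤b i≤j
  a≢j : a ≢ j
  a≢j a≡j = a≢i (collapse a≡j (Pair-functional ab (subst (λ x → Pair C x i) (sym a≡j) (Pair-sym ij))))
  b≢i : b ≢ i
  b≢i b≡i = a≢i (collapse (Pair-functional (Pair-sym ab) (subst (λ x → Pair C x j) (sym b≡i) ij)) b≡i)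
  b≢j : b ≢ j
  b≢j b≡j = a≢i (Pair-functional (Pair-sym ab) (subst (λ x → Pair C x i) (sym b≡j) (Pair-sym ij)))

Assigned? : (τ : PA n) (k : Fin n) → Dec (Assigned τ k)
Assigned? τ k with τ k
... | nothing = no λ ()
... | just σ  = yes (σ , refl)

Pair? : (C : PA n) (a b : Fin n) → Dec (Pair C a b)
Pair? C a b with C a | C b
... | nothing | _       = no λ { (_ , _ , () , _) }
... | just σ  | nothing = no λ { (_ , _ , _ , () , _) }
... | just σ  | just σ' with ptr σ ≟ b | ptr σ' ≟ a
...   | yes p | yes p' = yes (σ , σ' , refl , refl , p , p')
...   | no ¬p | _      = no λ { (_ , _ , refl , _ , p , _) → ¬p p }
...   | yes _ | no ¬p' = no λ { (_ , _ , _ , refl , _ , p') → ¬p' p' }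

InArea? : (C : PA n) (k : Fin n) → Dec (InArea C k)
InArea? C k = any? λ a → any? λ b → Pair? C a b ×-dec a ≤? b ×-dec a ≤? k ×-dec k ≤? b

Assigned⇒is-just : {τ : PA n} {k : Fin n} → Assigned τ k → T (is-just (τ k))
Assigned⇒is-just (_ , e) rewrite e = _

PrivatePoint : PA n → PA n → Fin n → Fin n → Fin n → Set
PrivatePoint τ C i j k = Assigned τ k × ¬ InArea (remove C i j) k

Dominates-remove : {C τ : PA n} {i j : Fin n} → Dominates C τ
  → (∀ k → Assigned τ k → InArea (remove C i j) k) → Dominates (remove C i j) τ
Dominates-remove {C = C} {i = i} {j} (_ , C' , conf , closed , C'⊒C , C'⊒τ) cover =
  cover , C' , conf , closed , Extends-trans C'⊒C (Extends-remove C i j) , C'⊒τ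

Container⇒PrivatePoint : {C τ : PA n} {i j : Fin n} → Container C τ → Pair C i j → i ≤ᶠ j
  → ∃ (PrivatePoint τ C i j)
Container⇒PrivatePoint {C = C} {τ} {i} {j} (_ , _ , dom , minimal) ij i≤j
  with k , ¬covered ← ¬∀⟶∃¬ _ _ (λ k → Assigned? τ k →-dec InArea? (remove C i j) k)
                                (minimal i j ij i≤j ∘ Dominates-remove dom)
  = k , decidable-stable (Assigned? τ k) (λ ¬a → ¬covered (⊥-elim ∘ ¬a)) , ¬covered ∘ const

uncovered-by-remove⇒opens-at : {C : PA n} {i j k : Fin n} → Pair C i j → i ≤ᶠ j
  → (cover : InArea C k) → ¬ InArea (remove C i j) k → proj₁ cover ≡ i
uncovered-by-remove⇒opens-at {i = i} ij i≤j (a , b , ab , a≤b , area) uncovered =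
  decidable-stable (a ≟ i) λ a≢i → uncovered (a , b , Pair-remove ij ab i≤j a≤b a≢i , a≤b , area)

PrivatePoint-injective : {C τ : PA n} {i j i' j' k : Fin n} → Dominates C τ
  → Pair C i j → i ≤ᶠ j → Pair C i' j' → i' ≤ᶠ j'
  → PrivatePoint τ C i j k → PrivatePoint τ C i' j' k → i ≡ i'
PrivatePoint-injective (cover , _) ij i≤j i'j' i'≤j' (k∈τ , uncovered) (_ , uncovered') =
  trans (sym (uncovered-by-remove⇒opens-at ij i≤j covering uncovered))
        (uncovered-by-remove⇒opens-at i'j' i'≤j' covering uncovered')
  where covering = cover _ k∈τ

Opening : PA n → Fin n → Set
Opening C i = ∃ λ σ → C i ≡ just σ × i ≤ᶠ ptr σ

numPairs≤count : (C : PA n) (Q : Fin n → Bool) (f : ∀ {i} → Opening C i → Fin n)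
  → (∀ {i} (o : Opening C i) → T (Q (f o)))
  → (∀ {i i'} (o : Opening C i) (o' : Opening C i') → f o ≡ f o' → i ≡ i')
  → numPairs C ≤ count Q
numPairs≤count C Q f f∈Q f-inj = bound
  where
  -- The predicate counted by numPairs is local to Defs, so it is left to unification; this
  -- needs bound to be checked before the clauses of opening.
  opening : ∀ i → T _ → Opening C i
  bound : numPairs C ≤ count Q
  bound = count-≤-injection _ Q (λ i → f ∘ opening i) (λ i → f∈Q ∘ opening i)
            (λ p q → f-inj (opening _ p) (opening _ q))
  opening i with C i
  ... | just σ = λ le → σ , refl , ≤ᵇ⇒≤ (toℕ i) (toℕ (ptr σ)) le

Opening⇒Pair : {C : PA n} {i : Fin n} → Configuration C → ((σ , _) : Opening C i) → Pair C i (ptr σ)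
Opening⇒Pair ((_ , _ , ptr-sym , _) , ptr-assigned) (σ , e , _)
  with σ' , e' ← ptr-assigned _ σ e = σ , σ' , e , e' , refl , ptr-sym _ _ σ σ' e refl e'

numPairs≤suppSize : {C τ : PA n} → Configuration C → Container C τ → numPairs C ≤ suppSize τ
numPairs≤suppSize {n} {C} {τ} conf cont@(_ , _ , dom , _) =
  numPairs≤count C _ point (λ o → Assigned⇒is-just {τ = τ} (proj₁ (proj₂ (private-point o)))) point-injective
  where
  private-point : ∀ {i} (o : Opening C i) → ∃ (PrivatePoint τ C i (ptr (proj₁ o)))
  private-point o = Container⇒PrivatePoint cont (Opening⇒Pair conf o) (proj₂ (proj₂ o))
  point : ∀ {i} → Opening C i → Fin n
  point = proj₁ ∘ private-point
  point-injective : ∀ {i i'} (o : Opening C i) (o' : Opening C i') → point o ≡ point o' → i ≡ i'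
  point-injective o@(_ , _ , i≤j) o'@(_ , _ , i'≤j') eq =
    PrivatePoint-injective dom (Opening⇒Pair conf o) i≤j (Opening⇒Pair conf o') i'≤j'
      (proj₂ (private-point o)) (subst (PrivatePoint τ C _ _) (sym eq) (proj₂ (private-point o')))

proposition10 : ∀ (n : ℕ) (τ C : PA n) → Configuration C → Container C τ
                  → Consistent τ × numPairs C ≤ suppSize τ
proposition10 n τ C conf cont@(_ , _ , (_ , C' , (C'-consistent , _) , _ , _ , C'⊒τ) , _) =
  Consistent-downward C'⊒τ C'-consistent , numPairs≤suppSize conf cont
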